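{- Suppose that $\theta(n)=O(n^{\alpha})$ for some $\alpha\in(0,1]$. Then $\theta'(m)=O(m^{\beta})$, where $\beta=\frac{\alpha}{1+\alpha}$.
   Context: All graphs are finite and simple. A graph $G$ is interval colourable if it admits a proper edge-colouring $c\colon E(G)\to\mathbb{N}$ such that for every vertex $v$, the set $\{c(vw)\colon w\in N(v)\}$ consists of consecutive integers. The interval colouring thickness $\theta(G)$ is the minimum $k$ such that $E(G)$ can be partitioned into the edge sets of $k$ interval colourable subgraphs. $\theta(n)=\max\{\theta(G): |V(G)|=n\}$ and $\theta'(m)=\max\{\theta(G): |E(G)|=m\}$. Asymptotics are as $n\to\infty$, $m\to\infty$. -}

module Defs where

open import Data.Nat using (ℕ; _≤_; _^_; _*_; _≥_)
open import Data.Fin using (Fin; _<?_)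
open import Data.Bool using (Bool; true; false; _∧_; if_then_else_)
open import Data.List using (List; map; allFin)
open import Data.Nat.ListAction using (sum)
open import Data.Product using (Σ; _×_; ∃; ∃-syntax)
open import Data.Empty using (⊥)
open import Relation.Nullary using (¬_)
open import Relation.Nullary.Decidable using (⌊_⌋)
open import Relation.Binary.PropositionalEquality using (_≡_)
open import Data.Integer using (∣_∣)
import Data.Rational as ℚ
open ℚ using (ℚ; ↥_; ↧ₙ_)

record SimpleGraph (n : ℕ) : Set where
  field
    adj     : Fin n → Fin n → Bool
    symm    : ∀ v w → adj v w ≡ adj w v
    irrefl  : ∀ v → adj v v ≡ false
open SimpleGraph public

edgeCount : ∀ {n} → SimpleGraph n → ℕ
edgeCount {n} G =
  sum (map (λ i → sum (map (λ j → if (adj G i j ∧ ⌊ i <? j ⌋) then 1 else 0)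
                           (allFin n)))
           (allFin n))

-- Interval colourings of a (spanning) subgraph H, given by its edge
-- relation H v w (assumed symmetric).  c v w is the colour of edge vw.

IsIntervalColouring : ∀ {n} → (Fin n → Fin n → Set) → (Fin n → Fin n → ℕ) → Set
IsIntervalColouring {n} H c =
  (∀ v w → H v w → c v w ≡ c w v) ×
  (∀ v w w' → H v w → H v w' → c v w ≡ c v w' → w ≡ w') ×
  (∀ v w w' k → H v w → H v w' → c v w ≤ k → k ≤ c v w' →
     ∃[ u ] (H v u × c v u ≡ k))

IntervalColourable : ∀ {n} → (Fin n → Fin n → Set) → Set
IntervalColourable {n} H = ∃[ c ] IsIntervalColouring H c

-- E(G) can be partitioned into the edge sets of k interval colourable
-- subgraphs: each edge vw gets a label part v w ∈ Fin k (symmetric), and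
-- for every label t the subgraph of edges labelled t is interval colourable.
PartitionInto : ∀ {n} → SimpleGraph n → ℕ → Set
PartitionInto {n} G k =
  Σ (Fin n → Fin n → Fin k) λ part →
    (∀ v w → adj G v w ≡ true → part v w ≡ part w v) ×
    (∀ (t : Fin k) →
       IntervalColourable (λ v w → adj G v w ≡ true × part v w ≡ t))

-- θ(G) ≤ k  (θ(G) is the least k with PartitionInto G k)
θ≤ : ∀ {n} → SimpleGraph n → ℕ → Set
θ≤ G k = PartitionInto G k

-- Real exponents, as Dedekind upper cuts of ℚ.
-- A real α is represented by Above r  ⇔  r > α.

record Real : Set₁ where
  field
    Above     : ℚ → Set
    inhabited : ∃[ r ] Above r
    bounded   : ∃[ r ] ¬ Above r
    upward    : ∀ {r s} → Above r → r ℚ.≤ s → Above s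
    rounded   : ∀ {r} → Above r → ∃[ s ] (s ℚ.< r × Above s)
open Real public

InUnitInterval : Real → Set
InUnitInterval α =
  (∃[ q ] (ℚ.0ℚ ℚ.< q × ¬ Above α q)) ×
  (∀ r → ℚ.1ℚ ℚ.< r → Above α r)

-- β = α / (1 + α), given by its upper set:
--   r > β  ⇔  ∃ s > α with s/(1+s) ≤ r  (i.e. s ≤ r(1+s), as 1+s > 0).
-- (For α > 0 this is exactly the set of rationals r > α/(1+α).)
AboveβOf : Real → ℚ → Set
AboveβOf α r = ∃[ s ] (Above α s × s ℚ.≤ r ℚ.* (ℚ.1ℚ ℚ.+ s))

-- For a positive rational r = p/q (lowest terms, q ≥ 1):
--   x ≤ C · n^r   ⇔   x^q ≤ C^q · n^p
LePowℚ : ℕ → ℕ → ℕ → ℚ → Set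
LePowℚ x C n r = x ^ (↧ₙ r) ≤ C ^ (↧ₙ r) * n ^ ∣ ↥ r ∣

-- For n ≥ 1 and a real exponent γ > 0 given by its upper set A = {r ∈ ℚ : r > γ}:
--   x ≤ C · n^γ   ⇔   ∀ rational r > γ, x ≤ C · n^r
-- (since n^γ = inf_{r > γ, r ∈ ℚ} n^r).
LePow : ℕ → ℕ → ℕ → (ℚ → Set) → Set
LePow x C n A = ∀ r → A r → LePowℚ x C n r

θn-BigO : Real → Set
θn-BigO α = ∃[ C ] ∃[ N ] (∀ n → n ≥ N → (G : SimpleGraph n) →
              ∃[ k ] (θ≤ G k × LePow k C n (Above α)))

θ'm-BigO : (ℚ → Set) → Set
θ'm-BigO Aβ = ∃[ C ] ∃[ M ] (∀ m → m ≥ M → ∀ n → (G : SimpleGraph n) →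
                edgeCount G ≡ m → ∃[ k ] (θ≤ G k × LePow k C m Aβ))

module Submission where

-- Let G have m edges and pick a threshold d.  At most 2m/d vertices have degree
-- at least d, so by hypothesis the subgraph they induce (padded to at least N
-- vertices) splits into C (2m/d + N + 1)^α interval colourable parts.  Every
-- other edge has an endpoint of degree below d; orienting these edges from low to
-- high degree (and by index between low vertices) gives an acyclic orientation
-- with out-degree below d, and ranking the out-edges of each vertex splits them
-- into d rooted forests, each of which is interval colourable.  Hence
-- θ(G) ≤ C (2m/d + N + 1)^α + d, and d ≈ m^(α/(1+α)) gives θ(G) = O(m^(α/(1+α))).
-- Real exponents are handled through rationals s > α and r > β; capping s at 2
-- keeps the constant independent of r, and the best d ≤ m is independent of r.

open import Data.Bool using (Bool; true; false; if_then_else_; _∧_; _∨_; not)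
open import Data.Bool.Properties using (∧-comm) renaming (_≟_ to _≟ᵇ_)
open import Data.Empty using (⊥-elim)
open import Data.Fin using (Fin; zero; suc; toℕ; fromℕ<; _↑ˡ_; _↑ʳ_; join; splitAt)
import Data.Fin as Fin
open import Data.Fin.Properties
  using (toℕ-↑ˡ; toℕ-↑ʳ; toℕ-injective; toℕ-fromℕ<; toℕ<n; join-splitAt; splitAt-join; any?)
import Data.Fin.Properties as Finₚ
open import Data.Integer as ℤ using (ℤ; ∣_∣)
import Data.Integer.Properties as ℤP
import Data.Integer.Tactic.RingSolver as ℤ-Solver
open import Data.List using (allFin; map; upTo)
import Data.List as List
open import Data.List.Extrema.Nat using (argmin; f[argmin]≤f[xs])
open import Data.List.Membership.Propositional.Properties using (∈-upTo⁺)
open import Data.List.Properties using (map-tabulate)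
import Data.List.Relation.Unary.All as All
open import Data.Nat
  using ( ℕ; zero; suc; _+_; _*_; _∸_; _^_; _⊔_; _≤_; _<_; _≥_; _≤?_; z≤n; s≤s; s≤s⁻¹
        ; NonZero; >-nonZero; >-nonZero⁻¹)
import Data.Nat.ListAction as ListAction
open import Data.Nat.Properties
open import Data.Nat.Tactic.RingSolver using (solve-∀)
open import Data.Product using (Σ; _×_; _,_; ∃-syntax; proj₁; proj₂)
import Data.Rational as ℚ
open ℚ using (ℚ; mkℚ; ↥_; ↧ₙ_; toℚᵘ)
import Data.Rational.Properties as ℚP
import Data.Rational.Unnormalised as ℚᵘ
import Data.Rational.Unnormalised.Properties as ℚᵘP
open import Data.Sum using (_⊎_; inj₁; inj₂)
open import Data.Unit using (tt)
open import Function using (_∘_)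
open import Relation.Binary.Core using (_⇔_)
open import Relation.Binary.Definitions using (tri<; tri≈; tri>)
open import Relation.Binary.PropositionalEquality
open import Relation.Nullary using (¬_; Dec; yes; no; does; contradiction)
open import Relation.Nullary.Decidable using (⌊_⌋; dec-true; dec-false; _×-dec_; toWitness)
open import Relation.Unary using (Decidable)

open import Algebra.Properties.CommutativeMonoid.Sum +-0-commutativeMonoid
  using (sum; ∑-distrib-+; ∑-comm; sum-cong-≗; sum-replicate-zero)

open import Defs

does≡true⇒ : ∀ {A : Set} (a? : Dec A) → does a? ≡ true → A
does≡true⇒ (yes a) _ = a

does≡false⇒ : ∀ {A : Set} (a? : Dec A) → does a? ≡ false → ¬ A
does≡false⇒ (no ¬a) _ = ¬a

does-cong : ∀ {A B : Set} → (A → B) → (B → A) →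
            (a? : Dec A) (b? : Dec B) → does a? ≡ does b?
does-cong A⇒B B⇒A (yes a) (yes b) = refl
does-cong A⇒B B⇒A (yes a) (no ¬b) = ⊥-elim (¬b (A⇒B a))
does-cong A⇒B B⇒A (no ¬a) (yes b) = ⊥-elim (¬a (B⇒A b))
does-cong A⇒B B⇒A (no ¬a) (no ¬b) = refl

∧≡true⇒ : ∀ {a b} → a ∧ b ≡ true → a ≡ true × b ≡ true
∧≡true⇒ {true} b≡true = refl , b≡true

∧≡true⇐ : ∀ {a b} → a ≡ true → b ≡ true → a ∧ b ≡ true
∧≡true⇐ refl b≡true = b≡true

indicator : Bool → ℕ
indicator b = if b then 1 else 0

count : ∀ {n} → (Fin n → Bool) → ℕ
count P = sum (indicator ∘ P)

rank : ∀ {n} → (Fin n → Bool) → Fin n → ℕ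
rank P zero    = 0
rank P (suc i) = indicator (P zero) + rank (P ∘ suc) i

sum-mono-≤ : ∀ {n} {f g : Fin n → ℕ} → (∀ i → f i ≤ g i) → sum f ≤ sum g
sum-mono-≤ {zero}  f≤g = z≤n
sum-mono-≤ {suc n} f≤g = +-mono-≤ (f≤g zero) (sum-mono-≤ (f≤g ∘ suc))

count-mono : ∀ {n} {P Q : Fin n → Bool} → (∀ i → P i ≡ true → Q i ≡ true) →
             count P ≤ count Q
count-mono {P = P} {Q} P⊆Q = sum-mono-≤ λ i → indicator-mono (P i) (Q i) (P⊆Q i)
  where
  indicator-mono : ∀ a b → (a ≡ true → b ≡ true) → indicator a ≤ indicator b
  indicator-mono true  b a⇒b rewrite a⇒b refl = ≤-refl
  indicator-mono false b a⇒b = z≤n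

count-false : ∀ n → count {n} (λ _ → false) ≡ 0
count-false n = sum-replicate-zero n

count*≤sum : ∀ {n} (P : Fin n → Bool) {d} {f : Fin n → ℕ} →
             (∀ i → P i ≡ true → d ≤ f i) → count P * d ≤ sum f
count*≤sum {zero}  P d≤f = z≤n
count*≤sum {suc n} P d≤f with P zero in P₀
... | true  = +-mono-≤ (d≤f zero P₀) (count*≤sum (P ∘ suc) (d≤f ∘ suc))
... | false = ≤-trans (count*≤sum (P ∘ suc) (d≤f ∘ suc)) (m≤n+m _ _)

rank≤count : ∀ {n} (P : Fin n → Bool) i → rank P i ≤ count P
rank≤count P zero    = z≤n
rank≤count P (suc i) = +-monoʳ-≤ (indicator (P zero)) (rank≤count (P ∘ suc) i)

rank<count : ∀ {n} (P : Fin n → Bool) {i} → P i ≡ true → rank P i < count P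
rank<count P {zero}  Pi rewrite Pi = s≤s z≤n
rank<count P {suc i} Pi = +-monoʳ-< (indicator (P zero)) (rank<count (P ∘ suc) Pi)

rank-injective : ∀ {n} (P : Fin n → Bool) {i j} → P i ≡ true → P j ≡ true →
                 rank P i ≡ rank P j → i ≡ j
rank-injective P {zero}  {zero}  Pi Pj eq = refl
rank-injective P {zero}  {suc j} Pi Pj eq rewrite Pi with () ← eq
rank-injective P {suc i} {zero}  Pi Pj eq rewrite Pj with () ← eq
rank-injective P {suc i} {suc j} Pi Pj eq =
  cong suc (rank-injective (P ∘ suc) Pi Pj (+-cancelˡ-≡ (indicator (P zero)) _ _ eq))

rank-surjective : ∀ {n} (P : Fin n → Bool) {k} → k < count P →
                  ∃[ i ] (P i ≡ true × rank P i ≡ k)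
rank-surjective {suc n} P {k} k<count with P zero in P₀
rank-surjective {suc n} P {zero}  k<count | true = zero , P₀ , refl
rank-surjective {suc n} P {suc k} (s≤s k<count) | true
  with i , Pi , rank≡k ← rank-surjective (P ∘ suc) k<count =
  suc i , Pi , trans (cong (λ b → indicator b + rank (P ∘ suc) i) P₀) (cong suc rank≡k)
rank-surjective {suc n} P {k} k<count | false
  with i , Pi , rank≡k ← rank-surjective (P ∘ suc) k<count =
  suc i , Pi , trans (cong (λ b → indicator b + rank (P ∘ suc) i) P₀) rank≡k

deg : ∀ {n} → SimpleGraph n → Fin n → ℕ
deg G v = count (adj G v)

sum-tabulate : ∀ {n} (f : Fin n → ℕ) → ListAction.sum (List.tabulate f) ≡ sum f
sum-tabulate {zero}  f = refl
sum-tabulate {suc n} f = cong (f zero +_) (sum-tabulate (f ∘ suc))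

sum-map-allFin : ∀ {n} (f : Fin n → ℕ) → ListAction.sum (map f (allFin n)) ≡ sum f
sum-map-allFin f = trans (cong ListAction.sum (map-tabulate (λ i → i) f)) (sum-tabulate f)

module _ {n} (G : SimpleGraph n) where

  forward : Fin n → Fin n → ℕ
  forward i j = indicator (adj G i j ∧ ⌊ i Fin.<? j ⌋)

  edgeCount≡sum-forward : edgeCount G ≡ sum (λ i → sum (forward i))
  edgeCount≡sum-forward =
    trans (sum-map-allFin (λ i → ListAction.sum (map (forward i) (allFin n))))
      (sum-cong-≗ λ i → sum-map-allFin (forward i))

  indicator-adj : ∀ i j → indicator (adj G i j) ≡ forward i j + forward j i
  indicator-adj i j with adj G i j in ij
  ... | false rewrite trans (symm G j i) ij = refl
  ... | true  rewrite trans (symm G j i) ij = exactly-one-order (i Fin.<? j) (j Fin.<? i)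
    where
    i≢j : i ≢ j
    i≢j refl with () ← trans (sym ij) (irrefl G i)
    exactly-one-order : (i<?j : Dec (i Fin.< j)) (j<?i : Dec (j Fin.< i)) →
                        1 ≡ indicator ⌊ i<?j ⌋ + indicator ⌊ j<?i ⌋
    exactly-one-order (yes i<j) (yes j<i) = ⊥-elim (<-asym i<j j<i)
    exactly-one-order (yes _)   (no _)    = refl
    exactly-one-order (no _)    (yes _)   = refl
    exactly-one-order (no i≮j)  (no j≮i)  =
      ⊥-elim (i≢j (toℕ-injective (≤-antisym (≮⇒≥ j≮i) (≮⇒≥ i≮j))))

  handshake : sum (deg G) ≡ edgeCount G + edgeCount G
  handshake = begin
    sum (λ i → sum (λ j → indicator (adj G i j)))
      ≡⟨ sum-cong-≗ (λ i → sum-cong-≗ (indicator-adj i)) ⟩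
    sum (λ i → sum (λ j → forward i j + forward j i))
      ≡⟨ sum-cong-≗ (λ i → ∑-distrib-+ (forward i) (λ j → forward j i)) ⟩
    sum (λ i → sum (forward i) + sum (λ j → forward j i))
      ≡⟨ ∑-distrib-+ (λ i → sum (forward i)) (λ i → sum (λ j → forward j i)) ⟩
    sum (λ i → sum (forward i)) + sum (λ i → sum (λ j → forward j i))
      ≡⟨ cong (sum (λ i → sum (forward i)) +_) (∑-comm (λ i j → forward j i)) ⟩
    sum (λ i → sum (forward i)) + sum (λ j → sum (forward j))
      ≡⟨ cong₂ _+_ edgeCount≡sum-forward edgeCount≡sum-forward ⟨
    edgeCount G + edgeCount G ∎
    where open ≡-Reasoning

-- Partitions into interval colourable classes

PartitionOf : ∀ {n} → (Fin n → Fin n → Set) → ℕ → Set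
PartitionOf {n} E k =
  Σ (Fin n → Fin n → Fin k) λ part →
    (∀ v w → E v w → part v w ≡ part w v) ×
    (∀ t → IntervalColourable (λ v w → E v w × part v w ≡ t))

record NeighbourhoodEmbedding {n n'} (ι : Fin n → Fin n')
         (E : Fin n → Fin n → Set) (F : Fin n' → Fin n' → Set) : Set where
  field
    hom       : ∀ {v w} → E v w → F (ι v) (ι w)
    lift      : ∀ {v w j} → E v w → F (ι v) j → ∃[ u ] (E v u × ι u ≡ j)
    injective : ∀ {v w w'} → E v w → E v w' → ι w ≡ ι w' → w ≡ w'

IsIntervalColouring-pullback :
  ∀ {n n'} {ι : Fin n → Fin n'} {E F c} → NeighbourhoodEmbedding ι E F →
  IsIntervalColouring F c → IsIntervalColouring E (λ v w → c (ι v) (ι w))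
IsIntervalColouring-pullback {ι = ι} {c = c} emb (c-sym , c-proper , c-consecutive) =
  (λ v w vw → c-sym (ι v) (ι w) (hom vw)) ,
  (λ v w w' vw vw' eq → injective vw vw' (c-proper _ _ _ (hom vw) (hom vw') eq)) ,
  λ v w w' k vw vw' lo hi →
    let j , vj , cj = c-consecutive _ _ _ k (hom vw) (hom vw') lo hi
        u , vu , ιu = lift vw vj
    in u , vu , trans (cong (c (ι v)) ιu) cj
  where open NeighbourhoodEmbedding emb

module _ {n n' : ℕ} {ι : Fin n → Fin n'} {E F} (emb : NeighbourhoodEmbedding ι E F) where
  open NeighbourhoodEmbedding emb

  restrict : ∀ {k} (part : Fin n' → Fin n' → Fin k) t →
             NeighbourhoodEmbedding ι (λ v w → E v w × part (ι v) (ι w) ≡ t)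
                                      (λ i j → F i j × part i j ≡ t)
  restrict part t = record
    { hom       = λ (vw , p) → hom vw , p
    ; lift      = λ (vw , _) (vj , p) →
                    let u , vu , ιu = lift vw vj in u , (vu , trans (cong (part _) ιu) p) , ιu
    ; injective = λ (vw , _) (vw' , _) → injective vw vw'
    }

  PartitionOf-pullback : ∀ {k} → PartitionOf F k → PartitionOf E k
  PartitionOf-pullback (part , part-sym , colourable) =
    (λ v w → part (ι v) (ι w)) ,
    (λ v w vw → part-sym (ι v) (ι w) (hom vw)) ,
    λ t → let c , c-interval = colourable t
          in _ , IsIntervalColouring-pullback (restrict part t) c-interval

IntervalColourable-⇔ : ∀ {n} {E F : Fin n → Fin n → Set} → E ⇔ F →
                       IntervalColourable F → IntervalColourable E
IntervalColourable-⇔ (E⇒F , F⇒E) (c , c-interval) =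
  c , IsIntervalColouring-pullback
        (record { hom = E⇒F ; lift = λ _ vj → _ , F⇒E vj , refl ; injective = λ _ _ eq → eq })
        c-interval

module _ {n k₁ k₂ : ℕ} {E : Fin n → Fin n → Set} (s : Fin n → Fin n → Bool)
         (s-sym : ∀ {v w} → E v w → s v w ≡ s w v) where

  PartitionOf-split : PartitionOf (λ v w → E v w × s v w ≡ true) k₁ →
                      PartitionOf (λ v w → E v w × s v w ≡ false) k₂ →
                      PartitionOf E (k₁ + k₂)
  PartitionOf-split (part₁ , part₁-sym , colourable₁) (part₂ , part₂-sym , colourable₂) =
    (λ v w → join k₁ k₂ (side v w)) , part-sym , colourable
    where
    side : Fin n → Fin n → Fin k₁ ⊎ Fin k₂
    side v w with s v w
    ... | true  = inj₁ (part₁ v w)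
    ... | false = inj₂ (part₂ v w)

    part-sym : ∀ v w → E v w → join k₁ k₂ (side v w) ≡ join k₁ k₂ (side w v)
    part-sym v w vw with s v w in svw | s w v | s-sym vw
    ... | true  | true  | refl = cong (λ i → join k₁ k₂ (inj₁ i)) (part₁-sym v w (vw , svw))
    ... | false | false | refl = cong (λ j → join k₁ k₂ (inj₂ j)) (part₂-sym v w (vw , svw))

    side-true : ∀ {v w} → s v w ≡ true → side v w ≡ inj₁ (part₁ v w)
    side-true {v} {w} svw with s v w
    ... | true = refl

    side-false : ∀ {v w} → s v w ≡ false → side v w ≡ inj₂ (part₂ v w)
    side-false {v} {w} svw with s v w
    ... | false = refl

    side≡inj₁ : ∀ {v w i} → side v w ≡ inj₁ i → s v w ≡ true × part₁ v w ≡ i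
    side≡inj₁ {v} {w} eq with s v w
    side≡inj₁ refl | true = refl , refl

    side≡inj₂ : ∀ {v w j} → side v w ≡ inj₂ j → s v w ≡ false × part₂ v w ≡ j
    side≡inj₂ {v} {w} eq with s v w
    side≡inj₂ refl | false = refl , refl

    join≡⇒≡splitAt : ∀ {x t} → join k₁ k₂ x ≡ t → x ≡ splitAt k₁ t
    join≡⇒≡splitAt {x} refl = sym (splitAt-join k₁ k₂ x)

    ≡splitAt⇒join≡ : ∀ {x t} → x ≡ splitAt k₁ t → join k₁ k₂ x ≡ t
    ≡splitAt⇒join≡ {t = t} refl = join-splitAt k₁ k₂ t

    colourable : ∀ t → IntervalColourable (λ v w → E v w × join k₁ k₂ (side v w) ≡ t)
    colourable t with splitAt k₁ t in split
    ... | inj₁ i = IntervalColourable-⇔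
      ( (λ (vw , p) → let svw , p₁ = side≡inj₁ (trans (join≡⇒≡splitAt p) split)
                      in (vw , svw) , p₁)
      , (λ ((vw , svw) , p₁) →
           vw , ≡splitAt⇒join≡ (trans (side-true svw) (trans (cong inj₁ p₁) (sym split)))))
      (colourable₁ i)
    ... | inj₂ j = IntervalColourable-⇔
      ( (λ (vw , p) → let svw , p₂ = side≡inj₂ (trans (join≡⇒≡splitAt p) split)
                      in (vw , svw) , p₂)
      , (λ ((vw , svw) , p₂) →
           vw , ≡splitAt⇒join≡ (trans (side-false svw) (trans (cong inj₂ p₂) (sym split)))))
      (colourable₂ j)

-- Rooted forests

level-asym : ∀ {n K} {R : Fin n → Fin n → Bool} (level : Fin n → Fin K) →
             (∀ {x y} → R x y ≡ true → toℕ (level x) < toℕ (level y)) →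
             ∀ {x y} → R x y ≡ true → R y x ≡ false
level-asym {R = R} level level-R {x} {y} xRy with R y x in yRx
... | false = refl
... | true  = ⊥-elim (<-asym (level-R xRy) (level-R yRx))

-- x ⇝ p says that p is the parent of x
module Forest {n K : ℕ} (_⇝_ : Fin n → Fin n → Bool)
  (⇝-functional : ∀ {x p q} → x ⇝ p ≡ true → x ⇝ q ≡ true → p ≡ q)
  (level : Fin n → Fin K)
  (level-⇝ : ∀ {x p} → x ⇝ p ≡ true → toℕ (level x) < toℕ (level p)) where

  Tree : Fin n → Fin n → Set
  Tree v w = v ⇝ w ≡ true ⊎ w ⇝ v ≡ true

  ⇝-asym : ∀ {x p} → x ⇝ p ≡ true → p ⇝ x ≡ false
  ⇝-asym = level-asym level level-⇝

  HasParent : Fin n → Set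
  HasParent x = ∃[ p ] (x ⇝ p ≡ true)

  parent? : ∀ x → Dec (HasParent x)
  parent? x = any? (λ p → x ⇝ p ≟ᵇ true)

  childRank : Fin n → Fin n → ℕ
  childRank p = rank (_⇝ p)

  childCount : Fin n → ℕ
  childCount p = count (_⇝ p)

  -- The edges at p get the colours offset p, offset p + 1, ...: the edge to
  -- the parent of p comes first, then the edges to the children in order.
  offsetFrom : ℕ → Fin n → ℕ
  offsetFrom c p with parent? p
  ... | yes _ = suc c
  ... | no  _ = 0

  -- colour′ f x is the colour of the edge from x to its parent, computed
  -- with fuel f; the fuel is sufficient once it exceeds K minus the level.
  colour′ : ℕ → Fin n → ℕ
  colour′ zero    x = 0
  colour′ (suc f) x with parent? x
  ... | yes (p , _) = offsetFrom (colour′ f p) p + childRank p x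
  ... | no  _       = 0

  colour′-stable : ∀ {f g} x → K ≤ f + toℕ (level x) → f ≤ g →
                   colour′ g x ≡ colour′ f x
  colour′-stable {zero} x K≤ _ = ⊥-elim (<-irrefl refl (<-≤-trans (toℕ<n (level x)) K≤))
  colour′-stable {suc f} {suc g} x K≤ (s≤s f≤g) with parent? x
  ... | no _ = refl
  ... | yes (p , x⇝p) =
    cong (λ c → offsetFrom c p + childRank p x) (colour′-stable p K≤f+level[p] f≤g)
    where
    K≤f+level[p] : K ≤ f + toℕ (level p)
    K≤f+level[p] = ≤-trans K≤ (≤-trans (≤-reflexive (sym (+-suc f _))) (+-monoʳ-≤ f (level-⇝ x⇝p)))

  colour : Fin n → ℕ
  colour = colour′ (suc K)

  offset : Fin n → ℕ
  offset p = offsetFrom (colour p) p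

  colour-⇝ : ∀ {x p} → x ⇝ p ≡ true → colour x ≡ offset p + childRank p x
  colour-⇝ {x} {p} x⇝p with parent? x
  ... | no  noParent     = ⊥-elim (noParent (p , x⇝p))
  ... | yes (p' , x⇝p') with refl ← ⇝-functional x⇝p x⇝p' =
    cong (λ c → offsetFrom c p + childRank p x) (sym (colour′-stable p (m≤m+n K _) (n≤1+n K)))

  offset-parent : ∀ {p q} → p ⇝ q ≡ true → offset p ≡ suc (colour p)
  offset-parent {p} {q} p⇝q with parent? p
  ... | yes _ = refl
  ... | no noParent = ⊥-elim (noParent (q , p⇝q))

  root⊎parent : ∀ p → offset p ≡ 0 ⊎ HasParent p
  root⊎parent p with parent? p
  ... | yes hasParent = inj₂ hasParent
  ... | no  _         = inj₁ refl

  edgeColour : Fin n → Fin n → ℕ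
  edgeColour v w = if v ⇝ w then colour v else colour w

  edgeColour-parent : ∀ {v w} → v ⇝ w ≡ true → edgeColour v w ≡ colour v
  edgeColour-parent v⇝w rewrite v⇝w = refl

  edgeColour-child : ∀ {v w} → w ⇝ v ≡ true → edgeColour v w ≡ offset v + childRank v w
  edgeColour-child w⇝v rewrite ⇝-asym w⇝v = colour-⇝ w⇝v

  colour≤edgeColour : ∀ {v w p} → v ⇝ p ≡ true → Tree v w → colour v ≤ edgeColour v w
  colour≤edgeColour v⇝p (inj₁ v⇝w) = ≤-reflexive (sym (edgeColour-parent v⇝w))
  colour≤edgeColour {v} {w} v⇝p (inj₂ w⇝v) = begin
    colour v                   <⟨ n<1+n _ ⟩
    suc (colour v)             ≡⟨ offset-parent v⇝p ⟨
    offset v                   ≤⟨ m≤m+n _ _ ⟩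
    offset v + childRank v w   ≡⟨ edgeColour-child w⇝v ⟨
    edgeColour v w             ∎
    where open ≤-Reasoning

  tree-intervalColouring : IsIntervalColouring Tree edgeColour
  tree-intervalColouring = symmetric , proper , consecutive
    where
    symmetric : ∀ v w → Tree v w → edgeColour v w ≡ edgeColour w v
    symmetric v w (inj₁ v⇝w) rewrite v⇝w | ⇝-asym v⇝w = refl
    symmetric v w (inj₂ w⇝v) rewrite w⇝v | ⇝-asym w⇝v = refl

    parent≢child : ∀ {v w w'} → v ⇝ w ≡ true → w' ⇝ v ≡ true →
                   edgeColour v w ≢ edgeColour v w'
    parent≢child {v} {w} {w'} v⇝w w'⇝v eq = m≢1+m+n (colour v) (begin
      colour v                        ≡⟨ edgeColour-parent v⇝w ⟨
      edgeColour v w                  ≡⟨ eq ⟩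
      edgeColour v w'                 ≡⟨ edgeColour-child w'⇝v ⟩
      offset v + childRank v w'       ≡⟨ cong (_+ childRank v w') (offset-parent v⇝w) ⟩
      suc (colour v) + childRank v w' ∎)
      where open ≡-Reasoning

    proper : ∀ v w w' → Tree v w → Tree v w' → edgeColour v w ≡ edgeColour v w' → w ≡ w'
    proper v w w' (inj₁ v⇝w) (inj₁ v⇝w') eq = ⇝-functional v⇝w v⇝w'
    proper v w w' (inj₁ v⇝w) (inj₂ w'⇝v) eq = ⊥-elim (parent≢child v⇝w w'⇝v eq)
    proper v w w' (inj₂ w⇝v) (inj₁ v⇝w') eq = ⊥-elim (parent≢child v⇝w' w⇝v (sym eq))
    proper v w w' (inj₂ w⇝v) (inj₂ w'⇝v) eq =
      rank-injective (_⇝ v) w⇝v w'⇝v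
        (+-cancelˡ-≡ (offset v) _ _
          (trans (sym (edgeColour-child w⇝v)) (trans eq (edgeColour-child w'⇝v))))

    below-offset : ∀ {v w k} → Tree v w → edgeColour v w ≤ k → k < offset v →
                   ∃[ u ] (Tree v u × edgeColour v u ≡ k)
    below-offset {v} {w} {k} vw lo k<offset with root⊎parent v
    ... | inj₁ offset≡0 = ⊥-elim (n≮0 (<-≤-trans k<offset (≤-reflexive offset≡0)))
    ... | inj₂ (p , v⇝p) =
      p , inj₁ v⇝p ,
      trans (edgeColour-parent v⇝p)
            (≤-antisym (≤-trans (colour≤edgeColour v⇝p vw) lo)
                       (s≤s⁻¹ (≤-trans k<offset (≤-reflexive (offset-parent v⇝p)))))

    from-offset : ∀ {v w k} → Tree v w → k ≤ edgeColour v w → offset v ≤ k →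
                  ∃[ u ] (Tree v u × edgeColour v u ≡ k)
    from-offset {v} {w} {k} (inj₁ v⇝w) hi offset≤k =
      ⊥-elim (<-irrefl refl (begin-strict
        colour v        <⟨ n<1+n _ ⟩
        suc (colour v)  ≡⟨ offset-parent v⇝w ⟨
        offset v        ≤⟨ offset≤k ⟩
        k               ≤⟨ hi ⟩
        edgeColour v w  ≡⟨ edgeColour-parent v⇝w ⟩
        colour v        ∎))
      where open ≤-Reasoning
    from-offset {v} {w} {k} (inj₂ w⇝v) hi offset≤k =
      u , inj₂ u⇝v ,
      trans (edgeColour-child u⇝v) (trans (cong (offset v +_) rank≡) (m+[n∸m]≡n offset≤k))
      where
      k∸offset<childCount : k ∸ offset v < childCount v
      k∸offset<childCount = begin-strict
        k ∸ offset v                         ≤⟨ ∸-monoˡ-≤ (offset v) hi ⟩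
        edgeColour v w ∸ offset v            ≡⟨ cong (_∸ offset v) (edgeColour-child w⇝v) ⟩
        offset v + childRank v w ∸ offset v  ≡⟨ m+n∸m≡n (offset v) _ ⟩
        childRank v w                        <⟨ rank<count (_⇝ v) w⇝v ⟩
        childCount v                         ∎
        where open ≤-Reasoning
      found : ∃[ u ] (u ⇝ v ≡ true × childRank v u ≡ k ∸ offset v)
      found = rank-surjective (_⇝ v) k∸offset<childCount
      u : Fin n
      u = proj₁ found
      u⇝v : u ⇝ v ≡ true
      u⇝v = proj₁ (proj₂ found)
      rank≡ : childRank v u ≡ k ∸ offset v
      rank≡ = proj₂ (proj₂ found)

    consecutive : ∀ v w w' k → Tree v w → Tree v w' →
                  edgeColour v w ≤ k → k ≤ edgeColour v w' → ∃[ u ] (Tree v u × edgeColour v u ≡ k)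
    consecutive v w w' k vw vw' lo hi with k <? offset v
    ... | yes k<offset = below-offset vw lo k<offset
    ... | no  k≮offset = from-offset vw' hi (≮⇒≥ k≮offset)

-- An orientation of E along which the level increases, with out-degrees below d,
-- splits E into d rooted forests: the edge v → w goes into the class given by the
-- rank of w among the out-neighbours of v.
module _ {n K d : ℕ} {E : Fin n → Fin n → Set} (E-sym : ∀ {v w} → E v w → E w v)
  (up : Fin n → Fin n → Bool)
  (up⇒E : ∀ {v w} → up v w ≡ true → E v w)
  (E⇒up : ∀ {v w} → E v w → up v w ≡ true ⊎ up w v ≡ true)
  (level : Fin n → Fin K)
  (level-up : ∀ {v w} → up v w ≡ true → toℕ (level v) < toℕ (level w))
  (outdegree< : ∀ v → count (up v) < d) where

  private
    orientedRank : Fin n → Fin n → ℕ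
    orientedRank v w = if up v w then rank (up v) w else rank (up w) v

    orientedRank< : ∀ v w → orientedRank v w < d
    orientedRank< v w with up v w
    ... | true  = ≤-<-trans (rank≤count (up v) w) (outdegree< v)
    ... | false = ≤-<-trans (rank≤count (up w) v) (outdegree< w)

    orientedRank-up : ∀ {v w} → up v w ≡ true → orientedRank v w ≡ rank (up v) w
    orientedRank-up vw rewrite vw = refl

    orientedRank-down : ∀ {v w} → up w v ≡ true → orientedRank v w ≡ rank (up w) v
    orientedRank-down wv rewrite level-asym level level-up wv = refl

    part : Fin n → Fin n → Fin d
    part v w = fromℕ< (orientedRank< v w)

    part≡⇒ : ∀ {v w t} → part v w ≡ t → orientedRank v w ≡ toℕ t
    part≡⇒ {v} {w} refl = sym (toℕ-fromℕ< (orientedRank< v w))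

    part≡⇐ : ∀ {v w t} → orientedRank v w ≡ toℕ t → part v w ≡ t
    part≡⇐ {v} {w} eq = toℕ-injective (trans (toℕ-fromℕ< (orientedRank< v w)) eq)

    part-sym : ∀ v w → E v w → part v w ≡ part w v
    part-sym v w vw = part≡⇐ (symmetric (E⇒up vw))
      where
      symmetric : up v w ≡ true ⊎ up w v ≡ true → orientedRank v w ≡ toℕ (part w v)
      symmetric (inj₁ up-vw) =
        trans (orientedRank-up up-vw) (sym (trans (toℕ-fromℕ< _) (orientedRank-down up-vw)))
      symmetric (inj₂ up-wv) =
        trans (orientedRank-down up-wv) (sym (trans (toℕ-fromℕ< _) (orientedRank-up up-wv)))

    _⇝[_]_ : Fin n → Fin d → Fin n → Bool
    v ⇝[ t ] w = up v w ∧ does (rank (up v) w ≟ toℕ t)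

    ⇝-up : ∀ {v w t} → v ⇝[ t ] w ≡ true → up v w ≡ true
    ⇝-up = proj₁ ∘ ∧≡true⇒

    ⇝-rank : ∀ {v w t} → v ⇝[ t ] w ≡ true → rank (up v) w ≡ toℕ t
    ⇝-rank {v} {w} {t} = does≡true⇒ (rank (up v) w ≟ toℕ t) ∘ proj₂ ∘ ∧≡true⇒

    ⇝-intro : ∀ {v w t} → up v w ≡ true → rank (up v) w ≡ toℕ t → v ⇝[ t ] w ≡ true
    ⇝-intro {v} {w} {t} vw eq = ∧≡true⇐ vw (dec-true (rank (up v) w ≟ toℕ t) eq)

    ⇝-functional : ∀ {t x p q} → x ⇝[ t ] p ≡ true → x ⇝[ t ] q ≡ true → p ≡ q
    ⇝-functional x⇝p x⇝q =
      rank-injective _ (⇝-up x⇝p) (⇝-up x⇝q) (trans (⇝-rank x⇝p) (sym (⇝-rank x⇝q)))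

    module Class (t : Fin d) = Forest (_⇝[ t ]_) ⇝-functional level (level-up ∘ ⇝-up)

    class⇔tree : ∀ t → (λ v w → E v w × part v w ≡ t) ⇔ Class.Tree t
    class⇔tree t = to , from
      where
      to : ∀ {v w} → E v w × part v w ≡ t → Class.Tree t v w
      to (vw , p) with E⇒up vw
      ... | inj₁ up-vw =
        inj₁ (⇝-intro up-vw (trans (sym (orientedRank-up up-vw)) (part≡⇒ p)))
      ... | inj₂ up-wv =
        inj₂ (⇝-intro up-wv (trans (sym (orientedRank-down up-wv)) (part≡⇒ p)))
      from : ∀ {v w} → Class.Tree t v w → E v w × part v w ≡ t
      from (inj₁ v⇝w) =
        up⇒E (⇝-up v⇝w) ,
        part≡⇐ (trans (orientedRank-up (⇝-up v⇝w)) (⇝-rank v⇝w))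
      from (inj₂ w⇝v) =
        E-sym (up⇒E (⇝-up w⇝v)) ,
        part≡⇐ (trans (orientedRank-down (⇝-up w⇝v)) (⇝-rank w⇝v))

  PartitionOf-orientation : PartitionOf E d
  PartitionOf-orientation =
    part , part-sym ,
    λ t → IntervalColourable-⇔ (class⇔tree t) (_ , Class.tree-intervalColouring t)

-- Splitting a graph at a degree threshold

InducedEdge : ∀ {n} → SimpleGraph n → (Fin n → Bool) → Fin n → Fin n → Set
InducedEdge G S v w = adj G v w ≡ true × S v ∧ S w ≡ true

module Image {n n' : ℕ} (G : SimpleGraph n) (S : Fin n → Bool) (ι : Fin n → Fin n')
  (ι-injective : ∀ {x y} → S x ≡ true → S y ≡ true → ι x ≡ ι y → x ≡ y) where

  ImageEdge : Fin n' → Fin n' → Set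
  ImageEdge i j = ∃[ v ] ∃[ w ] (InducedEdge G S v w × ι v ≡ i × ι w ≡ j)

  imageEdge? : ∀ i j → Dec (ImageEdge i j)
  imageEdge? i j = any? λ v → any? λ w →
    ((adj G v w ≟ᵇ true) ×-dec (S v ∧ S w ≟ᵇ true)) ×-dec
    (ι v Fin.≟ i) ×-dec (ι w Fin.≟ j)

  swap : ∀ {i j} → ImageEdge i j → ImageEdge j i
  swap {i} {j} (v , w , (vw , Svw) , ιv , ιw) =
    w , v , (trans (symm G w v) vw , trans (∧-comm (S w) (S v)) Svw) , ιw , ιv

  graph : SimpleGraph n'
  graph = record
    { adj    = λ i j → does (imageEdge? i j)
    ; symm   = λ i j → does-cong swap swap (imageEdge? i j) (imageEdge? j i)
    ; irrefl = λ i → dec-false (imageEdge? i i) loop-free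
    }
    where
    loop-free : ∀ {i} → ¬ ImageEdge i i
    loop-free (v , w , (vw , Svw) , ιv , ιw)
      with Sv , Sw ← ∧≡true⇒ Svw
      with refl ← ι-injective Sv Sw (trans ιv (sym ιw))
      with () ← trans (sym vw) (irrefl G v)

  embedding : NeighbourhoodEmbedding ι (InducedEdge G S) (λ i j → adj graph i j ≡ true)
  embedding = record
    { hom       = λ {v} {w} vw → dec-true (imageEdge? (ι v) (ι w)) (v , w , vw , refl , refl)
    ; lift      = lift
    ; injective = λ (_ , Svw) (_ , Svw') →
                    ι-injective (proj₂ (∧≡true⇒ Svw)) (proj₂ (∧≡true⇒ Svw'))
    }
    where
    lift : ∀ {v w j} → InducedEdge G S v w → adj graph (ι v) j ≡ true →
           ∃[ u ] (InducedEdge G S v u × ι u ≡ j)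
    lift {v} {w} {j} (_ , Svw) e
      with v' , u , v'u , ιv' , ιu ← does≡true⇒ (imageEdge? (ι v) j) e
      with refl ← ι-injective (proj₁ (∧≡true⇒ (proj₂ v'u))) (proj₁ (∧≡true⇒ Svw)) ιv'
      = u , v'u , ιu

module DegreeSplit {n} (G : SimpleGraph n) (d : ℕ) .{{_ : NonZero d}} where

  high : Fin n → Bool
  high v = does (d ≤? deg G v)

  count-high*d≤ : count high * d ≤ edgeCount G + edgeCount G
  count-high*d≤ = ≤-trans (count*≤sum high (λ v → does≡true⇒ (d ≤? deg G v)))
                          (≤-reflexive (handshake G))

  compress : ∀ N → Fin n → Fin (suc (count high + N))
  compress N v = fromℕ< (s≤s (≤-trans (rank≤count high v) (m≤m+n _ N)))

  compress-injective : ∀ {N x y} → high x ≡ true → high y ≡ true →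
                       compress N x ≡ compress N y → x ≡ y
  compress-injective hx hy eq =
    rank-injective high hx hy
      (trans (sym (toℕ-fromℕ< _)) (trans (cong toℕ eq) (toℕ-fromℕ< _)))

  -- padded with N + 1 isolated vertices, so that θ(n) = O(n^α), which holds
  -- only for n ≥ N, applies to it
  highGraph : ∀ N → SimpleGraph (suc (count high + N))
  highGraph N = Image.graph G high (compress N) compress-injective

  LowEdge : Fin n → Fin n → Set
  LowEdge v w = adj G v w ≡ true × high v ∧ high w ≡ false

  up : Fin n → Fin n → Bool
  up v w = not (high v) ∧ adj G v w ∧ (high w ∨ does (v Fin.<? w))

  level : Fin n → Fin (n + n)
  level v = if high v then n ↑ʳ v else v ↑ˡ n

  LowEdge-sym : ∀ {v w} → LowEdge v w → LowEdge w v
  LowEdge-sym {v} {w} (vw , hvw) = trans (symm G w v) vw , trans (∧-comm (high w) (high v)) hvw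

  up⇒low : ∀ {v w} → up v w ≡ true → high v ≡ false × adj G v w ≡ true
  up⇒low {v} {w} e with high v
  ... | false = refl , proj₁ (∧≡true⇒ e)

  up⇒LowEdge : ∀ {v w} → up v w ≡ true → LowEdge v w
  up⇒LowEdge {v} {w} e = proj₂ (up⇒low e) , cong (_∧ high w) (proj₁ (up⇒low e))

  up-intro : ∀ {v w} → high v ≡ false → adj G v w ≡ true → high w ≡ true ⊎ v Fin.< w →
             up v w ≡ true
  up-intro {v} {w} hv vw towards rewrite hv | vw with towards
  ... | inj₁ hw  rewrite hw = refl
  ... | inj₂ v<w with high w
  ...   | true  = refl
  ...   | false = dec-true (v Fin.<? w) v<w

  LowEdge⇒up : ∀ {v w} → LowEdge v w → up v w ≡ true ⊎ up w v ≡ true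
  LowEdge⇒up {v} {w} (vw , hvw) = by-cases (high v) (high w) refl refl hvw
    where
    wv : adj G w v ≡ true
    wv = trans (symm G w v) vw
    by-cases : ∀ a b → high v ≡ a → high w ≡ b → a ∧ b ≡ false →
               up v w ≡ true ⊎ up w v ≡ true
    by-cases false true  hv hw _ = inj₁ (up-intro hv vw (inj₁ hw))
    by-cases true  false hv hw _ = inj₂ (up-intro hw wv (inj₁ hv))
    by-cases false false hv hw _ with Finₚ.<-cmp v w
    ... | tri< v<w _ _ = inj₁ (up-intro hv vw (inj₂ v<w))
    ... | tri> _ _ w<v = inj₂ (up-intro hw wv (inj₂ w<v))
    ... | tri≈ _ refl _ with () ← trans (sym vw) (irrefl G v)

  level-up : ∀ {v w} → up v w ≡ true → toℕ (level v) < toℕ (level w)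
  level-up {v} {w} e with high v | high w
  ... | false | true  rewrite toℕ-↑ˡ v n | toℕ-↑ʳ n w = <-≤-trans (toℕ<n v) (m≤m+n n _)
  ... | false | false rewrite toℕ-↑ˡ v n | toℕ-↑ˡ w n =
    does≡true⇒ (v Fin.<? w) (proj₂ (∧≡true⇒ e))

  outdegree< : ∀ v → count (up v) < d
  outdegree< v = by-cases (high v) refl
    where
    by-cases : ∀ b → high v ≡ b → count (up v) < d
    by-cases true hv = begin-strict
      count (up v)            ≤⟨ count-mono (λ w e → contradiction (high-low {w} e) λ ()) ⟩
      count {n} (λ _ → false) ≡⟨ count-false n ⟩
      0                       <⟨ >-nonZero⁻¹ d ⟩
      d                       ∎
      where
      open ≤-Reasoning
      high-low : ∀ {w} → up v w ≡ true → true ≡ false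
      high-low {w} e = trans (sym hv) (proj₁ (up⇒low {v} {w} e))
    by-cases false hv = begin-strict
      count (up v)   ≤⟨ count-mono (λ w e → proj₂ (up⇒low {v} {w} e)) ⟩
      deg G v        <⟨ ≰⇒> (does≡false⇒ (d ≤? deg G v) hv) ⟩
      d              ∎
      where open ≤-Reasoning

  PartitionInto-split : ∀ {N k} → PartitionInto (highGraph N) k → PartitionInto G (k + d)
  PartitionInto-split {N} highPartition =
    PartitionOf-split (λ v w → high v ∧ high w) (λ {v} {w} _ → ∧-comm (high v) (high w))
      (PartitionOf-pullback (Image.embedding G high (compress N) compress-injective) highPartition)
      (PartitionOf-orientation LowEdge-sym up up⇒LowEdge LowEdge⇒up level level-up outdegree<)

^-distribʳ-* : ∀ x y k → (x * y) ^ k ≡ x ^ k * y ^ k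
^-distribʳ-* x y zero    = refl
^-distribʳ-* x y (suc k) = begin
  x * y * (x * y) ^ k         ≡⟨ cong (x * y *_) (^-distribʳ-* x y k) ⟩
  x * y * (x ^ k * y ^ k)     ≡⟨ interchange x y (x ^ k) (y ^ k) ⟩
  x * x ^ k * (y * y ^ k)     ∎
  where
  open ≡-Reasoning
  interchange : ∀ a b c e → a * b * (c * e) ≡ a * c * (b * e)
  interchange = solve-∀

^-cancelˡ-≤ : ∀ k .{{_ : NonZero k}} {x y} → x ^ k ≤ y ^ k → x ≤ y
^-cancelˡ-≤ k xᵏ≤yᵏ = ≮⇒≥ λ y<x → <⇒≱ (^-monoˡ-< k y<x) xᵏ≤yᵏ

^-swap : ∀ x a b → (x ^ a) ^ b ≡ (x ^ b) ^ a
^-swap x a b = begin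
  (x ^ a) ^ b ≡⟨ ^-*-assoc x a b ⟩
  x ^ (a * b) ≡⟨ cong (x ^_) (*-comm a b) ⟩
  x ^ (b * a) ≡⟨ ^-*-assoc x b a ⟨
  (x ^ b) ^ a ∎
  where open ≡-Reasoning

-- x ≤ C · m^(u/T), with both sides raised to the power T
record PowBound (x C m u T : ℕ) : Set where
  constructor powBound
  field
    pow-≤ : x ^ T ≤ C ^ T * m ^ u

PowBound-monoᶜ : ∀ {x C C' m u T} → C ≤ C' → PowBound x C m u T → PowBound x C' m u T
PowBound-monoᶜ {m = m} {u} {T} C≤C' (powBound bound) =
  powBound (≤-trans bound (*-monoˡ-≤ (m ^ u) (^-monoˡ-≤ T C≤C')))

PowBound-downward : ∀ {x y C m u T} → x ≤ y → PowBound y C m u T → PowBound x C m u T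
PowBound-downward {T = T} x≤y (powBound bound) = powBound (≤-trans (^-monoˡ-≤ T x≤y) bound)

PowBound-exponent : ∀ {x C m u T p q} .{{_ : NonZero T}} .{{_ : NonZero m}} →
                    u * q ≤ p * T → PowBound x C m u T → PowBound x C m p q
PowBound-exponent {x} {C} {m} {u} {T} {p} {q} uq≤pT (powBound bound) =
  powBound (^-cancelˡ-≤ T (begin
  (x ^ q) ^ T                  ≡⟨ ^-swap x q T ⟩
  (x ^ T) ^ q                  ≤⟨ ^-monoˡ-≤ q bound ⟩
  (C ^ T * m ^ u) ^ q          ≡⟨ ^-distribʳ-* (C ^ T) (m ^ u) q ⟩
  (C ^ T) ^ q * (m ^ u) ^ q    ≡⟨ cong₂ _*_ (^-swap C T q) (^-*-assoc m u q) ⟩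
  (C ^ q) ^ T * m ^ (u * q)    ≤⟨ *-monoʳ-≤ ((C ^ q) ^ T) (^-monoʳ-≤ m uq≤pT) ⟩
  (C ^ q) ^ T * m ^ (p * T)    ≡⟨ cong ((C ^ q) ^ T *_) (^-*-assoc m p T) ⟨
  (C ^ q) ^ T * (m ^ p) ^ T    ≡⟨ ^-distribʳ-* (C ^ q) (m ^ p) T ⟨
  (C ^ q * m ^ p) ^ T          ∎))
  where open ≤-Reasoning

PowBound-compose : ∀ {x y C D E m a b u v} → D ^ a ≤ E ^ b →
                   PowBound x C y a b → PowBound y D m u v → PowBound x (C * E) m (a * u) (b * v)
PowBound-compose {x} {y} {C} {D} {E} {m} {a} {b} {u} {v} Dᵃ≤Eᵇ
                 (powBound x-bound) (powBound y-bound) = powBound (begin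
  x ^ (b * v)                  ≡⟨ ^-*-assoc x b v ⟨
  (x ^ b) ^ v                  ≤⟨ ^-monoˡ-≤ v x-bound ⟩
  (C ^ b * y ^ a) ^ v          ≡⟨ ^-distribʳ-* (C ^ b) (y ^ a) v ⟩
  c * (y ^ a) ^ v              ≡⟨ cong (c *_) (^-swap y a v) ⟩
  c * (y ^ v) ^ a              ≤⟨ *-monoʳ-≤ c (^-monoˡ-≤ a y-bound) ⟩
  c * (D ^ v * m ^ u) ^ a      ≡⟨ cong (c *_) (^-distribʳ-* (D ^ v) (m ^ u) a) ⟩
  c * ((D ^ v) ^ a * M)        ≡⟨ cong (λ z → c * (z * M)) (^-swap D v a) ⟩
  c * ((D ^ a) ^ v * M)        ≤⟨ *-monoʳ-≤ c (*-monoˡ-≤ M (^-monoˡ-≤ v Dᵃ≤Eᵇ)) ⟩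
  c * ((E ^ b) ^ v * M)        ≡⟨ *-assoc c _ M ⟨
  c * (E ^ b) ^ v * M          ≡⟨ cong (_* M) (^-distribʳ-* (C ^ b) (E ^ b) v) ⟨
  (C ^ b * E ^ b) ^ v * M      ≡⟨ cong (λ z → z ^ v * M) (^-distribʳ-* C E b) ⟨
  ((C * E) ^ b) ^ v * M        ≡⟨ cong₂ _*_ (^-*-assoc (C * E) b v) Mᵃᵘ ⟩
  (C * E) ^ (b * v) * m ^ (a * u) ∎)
  where
  open ≤-Reasoning
  c M : ℕ
  c = (C ^ b) ^ v
  M = (m ^ u) ^ a
  Mᵃᵘ : M ≡ m ^ (a * u)
  Mᵃᵘ = trans (^-*-assoc m u a) (cong (m ^_) (*-comm u a))

PowBound-+ : ∀ {x y C m p q} → PowBound x C m p q → PowBound y C m p q →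
             PowBound (x + y) (2 * C) m p q
PowBound-+ {x} {y} {C} {m} {p} {q} x-bound y-bound = powBound (begin
  (x + y) ^ q              ≤⟨ ^-monoˡ-≤ q x+y≤2[x⊔y] ⟩
  (2 * (x ⊔ y)) ^ q        ≡⟨ ^-distribʳ-* 2 (x ⊔ y) q ⟩
  2 ^ q * (x ⊔ y) ^ q      ≤⟨ *-monoʳ-≤ (2 ^ q) ⊔-bound ⟩
  2 ^ q * (C ^ q * m ^ p)  ≡⟨ *-assoc (2 ^ q) _ _ ⟨
  2 ^ q * C ^ q * m ^ p    ≡⟨ cong (_* m ^ p) (^-distribʳ-* 2 C q) ⟨
  (2 * C) ^ q * m ^ p      ∎)
  where
  open ≤-Reasoning
  x+y≤2[x⊔y] : x + y ≤ 2 * (x ⊔ y)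
  x+y≤2[x⊔y] = +-mono-≤ (m≤m⊔n x y) (≤-trans (m≤n⊔m x y) (m≤m+n (x ⊔ y) 0))
  ⊔-bound : (x ⊔ y) ^ q ≤ C ^ q * m ^ p
  ⊔-bound with ⊔-sel x y
  ... | inj₁ x⊔y≡x rewrite x⊔y≡x = PowBound.pow-≤ x-bound
  ... | inj₂ x⊔y≡y rewrite x⊔y≡y = PowBound.pow-≤ y-bound

PowBound-quotient : ∀ {y d D m a b} .{{_ : NonZero m}} →
                    y * d ≤ D * m → m ^ a ≤ d ^ (a + b) → PowBound y D m b (a + b)
PowBound-quotient {y} {d} {D} {m} {a} {b} yd≤Dm mᵃ≤dᵃ⁺ᵇ = powBound (
  *-cancelʳ-≤ (y ^ (a + b)) (D ^ (a + b) * m ^ b) (m ^ a) {{m^n≢0 m a}} (begin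
    y ^ (a + b) * m ^ a             ≤⟨ *-monoʳ-≤ (y ^ (a + b)) mᵃ≤dᵃ⁺ᵇ ⟩
    y ^ (a + b) * d ^ (a + b)       ≡⟨ ^-distribʳ-* y d (a + b) ⟨
    (y * d) ^ (a + b)               ≤⟨ ^-monoˡ-≤ (a + b) yd≤Dm ⟩
    (D * m) ^ (a + b)               ≡⟨ ^-distribʳ-* D m (a + b) ⟩
    D ^ (a + b) * m ^ (a + b)       ≡⟨ cong (D ^ (a + b) *_) mᵃ⁺ᵇ ⟩
    D ^ (a + b) * (m ^ b * m ^ a)   ≡⟨ *-assoc (D ^ (a + b)) _ _ ⟨
    D ^ (a + b) * m ^ b * m ^ a     ∎))
  where
  open ≤-Reasoning
  mᵃ⁺ᵇ : m ^ (a + b) ≡ m ^ b * m ^ a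
  mᵃ⁺ᵇ = trans (cong (m ^_) (+-comm a b)) (^-distribˡ-+-* m b a)

PowBound-suc : ∀ {e m a k} .{{_ : NonZero m}} → e ^ k ≤ m ^ a → PowBound (suc e) 2 m a k
PowBound-suc {zero} {m} {a} {k} _ =
  powBound (≤-trans (≤-reflexive (^-zeroˡ k)) (*-mono-≤ (m^n>0 2 k) (m^n>0 m a)))
PowBound-suc {suc e} {m} {a} {k} eᵏ≤mᵃ = powBound (begin
  suc (suc e) ^ k    ≤⟨ ^-monoˡ-≤ k 2+e≤2[1+e] ⟩
  (2 * suc e) ^ k    ≡⟨ ^-distribʳ-* 2 (suc e) k ⟩
  2 ^ k * suc e ^ k  ≤⟨ *-monoʳ-≤ (2 ^ k) eᵏ≤mᵃ ⟩
  2 ^ k * m ^ a      ∎)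
  where
  open ≤-Reasoning
  double : ∀ e → suc (suc e) + e ≡ 2 * suc e
  double = solve-∀
  2+e≤2[1+e] : suc (suc e) ≤ 2 * suc e
  2+e≤2[1+e] = ≤-trans (m≤m+n (suc (suc e)) e) (≤-reflexive (double e))

^-double : ∀ D b → D ^ (2 * b) ≡ (D * D) ^ b
^-double D b = begin
  D ^ (2 * b)      ≡⟨ cong (λ k → D ^ (b + k)) (+-identityʳ b) ⟩
  D ^ (b + b)      ≡⟨ ^-distribˡ-+-* D b b ⟩
  D ^ b * D ^ b    ≡⟨ ^-distribʳ-* D D b ⟨
  (D * D) ^ b      ∎
  where open ≡-Reasoning

exponent-scale : ∀ a b p q → a * q ≤ p * (a + b) → (a * b) * q ≤ p * (b * (a + b))
exponent-scale a b p q aq≤p[a+b] = begin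
  (a * b) * q        ≡⟨ lhs a b q ⟩
  b * (a * q)        ≤⟨ *-monoʳ-≤ b aq≤p[a+b] ⟩
  b * (p * (a + b))  ≡⟨ rhs a b p ⟩
  p * (b * (a + b))  ∎
  where
  open ≤-Reasoning
  lhs : ∀ a b q → (a * b) * q ≡ b * (a * q)
  lhs = solve-∀
  rhs : ∀ a b p → b * (p * (a + b)) ≡ p * (b * (a + b))
  rhs = solve-∀

vertices*threshold≤ : ∀ {A N d m} → d ≤ m → A * d ≤ m + m → suc (A + N) * d ≤ (3 + N) * m
vertices*threshold≤ {A} {N} {d} {m} d≤m Ad≤2m = begin
  suc (A + N) * d        ≡⟨ expand A N d ⟩
  d + A * d + N * d      ≤⟨ +-mono-≤ (+-mono-≤ d≤m Ad≤2m) (*-monoʳ-≤ N d≤m) ⟩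
  m + (m + m) + N * m    ≡⟨ collect N m ⟩
  (3 + N) * m            ∎
  where
  open ≤-Reasoning
  expand : ∀ A N d → suc (A + N) * d ≡ d + A * d + N * d
  expand = solve-∀
  collect : ∀ N m → m + (m + m) + N * m ≡ (3 + N) * m
  collect = solve-∀

θ′-constant : ℕ → ℕ → ℕ
θ′-constant C N = 2 * (C * ((3 + N) * (3 + N)) + 2)

-- With m^a ≤ d^(a+b) and (d - 1)^(a+b) ≤ m^a for d = e + 1, that is d ≈ m^(s/(1+s))
-- for s = a/b, both parts of the degree split have size O(m^(p/q)).
threshold-bound :
  ∀ {C N m A e kA a b p q} .{{_ : NonZero m}} .{{_ : NonZero b}} →
  a ≤ 2 * b → a * q ≤ p * (a + b) →
  suc e ≤ m → A * suc e ≤ m + m → m ^ a ≤ suc e ^ (a + b) → e ^ (a + b) ≤ m ^ a →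
  PowBound kA C (suc (A + N)) a b →
  PowBound (kA + suc e) (θ′-constant C N) m p q
threshold-bound {C} {N} {m} {A} {e} {kA} {a} {b} {p} {q}
                a≤2b aq≤p[a+b] d≤m Ad≤2m mᵃ≤dᵃ⁺ᵇ eᵃ⁺ᵇ≤mᵃ kA-bound =
  PowBound-+ (PowBound-monoᶜ (m≤m+n K 2) high-bound) (PowBound-monoᶜ (m≤n+m 2 K) low-bound)
  where
  K : ℕ
  K = C * ((3 + N) * (3 + N))
  instance
    a+b≢0 : NonZero (a + b)
    a+b≢0 = >-nonZero (<-≤-trans (>-nonZero⁻¹ b) (m≤n+m b a))
    b[a+b]≢0 : NonZero (b * (a + b))
    b[a+b]≢0 = m*n≢0 b (a + b)
  vertex-bound : PowBound (suc (A + N)) (3 + N) m b (a + b)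
  vertex-bound = PowBound-quotient (vertices*threshold≤ {A} {N} d≤m Ad≤2m) mᵃ≤dᵃ⁺ᵇ
  high-bound : PowBound kA K m p q
  high-bound =
    PowBound-exponent (exponent-scale a b p q aq≤p[a+b])
      (PowBound-compose (≤-trans (^-monoʳ-≤ (3 + N) a≤2b) (≤-reflexive (^-double (3 + N) b)))
                        kA-bound vertex-bound)
  low-bound : PowBound (suc e) 2 m p q
  low-bound = PowBound-exponent aq≤p[a+b] (PowBound-suc {a = a} eᵃ⁺ᵇ≤mᵃ)

ℤ≤⇒ℕ≤ : ∀ a q c (P : ℤ) → ℤ.+ a ℤ.* ℤ.+ q ℤ.≤ P ℤ.* ℤ.+ suc c →
        a * q ≤ ∣ P ∣ * suc c
ℤ≤⇒ℕ≤ a q c (ℤ.+ p) h =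
  ℤP.drop‿+≤+ (subst₂ ℤ._≤_ (sym (ℤP.pos-* a q)) (sym (ℤP.pos-* p (suc c))) h)
ℤ≤⇒ℕ≤ a q c ℤ.-[1+ k ] h with () ← subst (ℤ._≤ _) (sym (ℤP.pos-* a q)) h

toℚᵘ-≤-*-1+ : ∀ (s r : ℚ) → s ℚ.≤ r ℚ.* (ℚ.1ℚ ℚ.+ s) →
              toℚᵘ s ℚᵘ.≤ toℚᵘ r ℚᵘ.* (ℚᵘ.1ℚᵘ ℚᵘ.+ toℚᵘ s)
toℚᵘ-≤-*-1+ s r s≤ = ℚᵘP.≤-respʳ-≃
  (ℚᵘP.≃-trans (ℚP.toℚᵘ-homo-* r (ℚ.1ℚ ℚ.+ s))
               (ℚᵘP.*-congˡ {toℚᵘ r} (ℚP.toℚᵘ-homo-+ ℚ.1ℚ s)))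
  (ℚP.toℚᵘ-mono-≤ s≤)

cross-multiply : ∀ {s r : ℚ} → ℚ.0ℚ ℚ.≤ s → s ℚ.≤ r ℚ.* (ℚ.1ℚ ℚ.+ s) →
                 ∣ ↥ s ∣ * ↧ₙ r ≤ ∣ ↥ r ∣ * (↧ₙ s + ∣ ↥ s ∣)
cross-multiply {s@(mkℚ (ℤ.+ a) b _)} {r@(mkℚ P q _)} _ s≤ with toℚᵘ-≤-*-1+ s r s≤
... | ℚᵘ.*≤* h =
  ℤ≤⇒ℕ≤ a (suc q) (b + a) P
    (ℤP.*-cancelʳ-≤-pos _ _ (ℤ.+ suc b)
      (subst₂ ℤ._≤_ (lhs (ℤ.+ a) (ℤ.+ suc q) (ℤ.+ suc b)) (rhs P (ℤ.+ a) (ℤ.+ suc b)) h))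
  where
  lhs : ∀ A Q B → A ℤ.* (Q ℤ.* (ℤ.+ 1 ℤ.* B)) ≡ (A ℤ.* Q) ℤ.* B
  lhs = ℤ-Solver.solve-∀
  rhs : ∀ P A B → (P ℤ.* (ℤ.+ 1 ℤ.* B ℤ.+ A ℤ.* ℤ.+ 1)) ℤ.* B ≡
                  (P ℤ.* (B ℤ.+ A)) ℤ.* B
  rhs = ℤ-Solver.solve-∀
cross-multiply {mkℚ ℤ.-[1+ _ ] _ _} (ℚ.*≤* ()) _

ratio-cap : ∀ {a b p q} → 2 * b < a → a * q ≤ p * (a + b) → 2 * q ≤ p * 3
ratio-cap {a} {b} {p} {q} 2b<a aq≤p[a+b] =
  *-cancelˡ-≤ a {{>-nonZero (≤-<-trans z≤n 2b<a)}} (begin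
  a * (2 * q)                 ≡⟨ left a q ⟩
  2 * (a * q)                 ≤⟨ *-monoʳ-≤ 2 aq≤p[a+b] ⟩
  2 * (p * (a + b))           ≡⟨ middle p a b ⟩
  2 * (p * a) + p * (2 * b)   ≤⟨ +-monoʳ-≤ (2 * (p * a)) (*-monoʳ-≤ p (<⇒≤ 2b<a)) ⟩
  2 * (p * a) + p * a         ≡⟨ right p a ⟩
  a * (p * 3)                 ∎)
  where
  open ≤-Reasoning
  left : ∀ a q → a * (2 * q) ≡ 2 * (a * q)
  left = solve-∀
  middle : ∀ p a b → 2 * (p * (a + b)) ≡ 2 * (p * a) + p * (2 * b)
  middle = solve-∀
  right : ∀ p a → 2 * (p * a) + p * a ≡ a * (p * 3)
  right = solve-∀

-- a rational s = a/b > α with s ≤ 2 and s/(1+s) = a/(a+b) ≤ r; the cap s ≤ 2,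
-- possible as α ≤ 1, makes the final constant independent of r
ExponentFor : Real → ℚ → Set
ExponentFor α r =
  ∃[ s ] (Above α s × ∣ ↥ s ∣ ≤ 2 * ↧ₙ s × ∣ ↥ s ∣ * ↧ₙ r ≤ ∣ ↥ r ∣ * (∣ ↥ s ∣ + ↧ₙ s))

exponent-witness : ∀ α → InUnitInterval α → ∀ r → AboveβOf α r → ExponentFor α r
exponent-witness α ((q₀ , 0<q₀ , ¬α<q₀) , α<1⁺) r (s , α<s , s≤r[1+s]) =
  cap (∣ ↥ s ∣ ≤? 2 * ↧ₙ s)
  where
  0≤s : ℚ.0ℚ ℚ.≤ s
  0≤s with ℚP.≤-total s q₀
  ... | inj₁ s≤q₀ = ⊥-elim (¬α<q₀ (upward α α<s s≤q₀))
  ... | inj₂ q₀≤s = ℚP.<⇒≤ (ℚP.<-≤-trans 0<q₀ q₀≤s)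

  cross : ∣ ↥ s ∣ * ↧ₙ r ≤ ∣ ↥ r ∣ * (∣ ↥ s ∣ + ↧ₙ s)
  cross = ≤-trans (cross-multiply {s} {r} 0≤s s≤r[1+s])
                  (≤-reflexive (cong (∣ ↥ r ∣ *_) (+-comm (↧ₙ s) _)))

  2ℚ : ℚ
  2ℚ = ℤ.+ 2 ℚ./ 1

  cap : Dec (∣ ↥ s ∣ ≤ 2 * ↧ₙ s) → ExponentFor α r
  cap (yes a≤2b) = s , α<s , a≤2b , cross
  cap (no  a≰2b) =
    2ℚ , α<1⁺ 2ℚ (toWitness {a? = ℚ.1ℚ ℚP.<? 2ℚ} tt) , ≤-refl ,
    ratio-cap {p = ∣ ↥ r ∣} {↧ₙ r} (≰⇒> a≰2b) cross

-- Choosing the threshold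

switch-point : ∀ {P : ℕ → Set} → Decidable P → ¬ P 0 → ∀ {m} → P m →
               ∃[ e ] (e < m × ¬ P e × P (suc e))
switch-point P? ¬P0 {zero}  P0  = ⊥-elim (¬P0 P0)
switch-point P? ¬P0 {suc m} Psm with P? m
... | no ¬Pm = m , n<1+n m , ¬Pm , Psm
... | yes Pm with e , e<m , ¬Pe , Pse ← switch-point P? ¬P0 Pm = e , m<n⇒m<1+n e<m , ¬Pe , Pse

module ThresholdPartitions {α : Real} {C N : ℕ}
  (θ≤Cnᵅ : ∀ n → n ≥ N → (G : SimpleGraph n) →
           ∃[ k ] (θ≤ G k × LePow k C n (Above α)))
  {n} (G : SimpleGraph n) where

  module At (e : ℕ) where
    open DegreeSplit G (suc e) public

    highPartition : ∃[ k ] (θ≤ (highGraph N) k × LePow k C (suc (count high + N)) (Above α))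
    highPartition = θ≤Cnᵅ (suc (count high + N)) (m≤n⇒m≤1+n (m≤n+m N _)) (highGraph N)

    size : ℕ
    size = proj₁ highPartition + suc e

    partition : θ≤ G size
    partition = PartitionInto-split (proj₁ (proj₂ highPartition))

  open At public using (size; partition)

  good-threshold : ∀ {m} .{{_ : NonZero m}} → edgeCount G ≡ m → ∀ r → ExponentFor α r →
                   ∃[ e ] (e < m × PowBound (size e) (θ′-constant C N) m ∣ ↥ r ∣ (↧ₙ r))
  good-threshold {m} |E|≡m r (s , α<s , a≤2b , aq≤p[a+b]) =
    e , e<m ,
    threshold-bound {C} {N} {A = count high} {kA = proj₁ highPartition}
      a≤2b aq≤p[a+b] e<m high*d≤2m mᵃ≤dᵃ⁺ᵇ (<⇒≤ (≰⇒> ¬mᵃ≤eᵃ⁺ᵇ))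
      (powBound (proj₂ (proj₂ highPartition) s α<s))
    where
    a b : ℕ
    a = ∣ ↥ s ∣
    b = ↧ₙ s
    switch : ∃[ e ] (e < m × ¬ m ^ a ≤ e ^ (a + b) × m ^ a ≤ suc e ^ (a + b))
    switch = switch-point (λ d → m ^ a ≤? d ^ (a + b))
      (λ mᵃ≤0 → <⇒≱ (m^n>0 m a) (subst (m ^ a ≤_) (cong (0 ^_) (+-comm a b)) mᵃ≤0))
      (^-monoʳ-≤ m (m≤m+n a b))
    e : ℕ
    e = proj₁ switch
    e<m : e < m
    e<m = proj₁ (proj₂ switch)
    ¬mᵃ≤eᵃ⁺ᵇ : ¬ m ^ a ≤ e ^ (a + b)
    ¬mᵃ≤eᵃ⁺ᵇ = proj₁ (proj₂ (proj₂ switch))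
    mᵃ≤dᵃ⁺ᵇ : m ^ a ≤ suc e ^ (a + b)
    mᵃ≤dᵃ⁺ᵇ = proj₂ (proj₂ (proj₂ switch))
    open At e using (high; highPartition; count-high*d≤)
    high*d≤2m : count high * suc e ≤ m + m
    high*d≤2m = subst (λ E → count high * suc e ≤ E + E) |E|≡m count-high*d≤

lemma8 : (α : Real) → InUnitInterval α → θn-BigO α → θ'm-BigO (AboveβOf α)
lemma8 α α∈⟨0,1] (C , N , θ≤Cnᵅ) = θ′-constant C N , 1 , bound
  where
  bound : ∀ m → m ≥ 1 → ∀ n (G : SimpleGraph n) → edgeCount G ≡ m →
          ∃[ k ] (θ≤ G k × LePow k (θ′-constant C N) m (AboveβOf α))
  bound m@(suc _) _ n G |E|≡m = size best , partition best , best-bound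
    where
    open ThresholdPartitions {α} {C} {N} θ≤Cnᵅ G
    best : ℕ
    best = argmin size 0 (upTo m)
    best-bound : LePow (size best) (θ′-constant C N) m (AboveβOf α)
    best-bound r β<r = PowBound.pow-≤ (PowBound-downward best≤ size-bound)
      where
      threshold : ∃[ e ] (e < m × PowBound (size e) (θ′-constant C N) m ∣ ↥ r ∣ (↧ₙ r))
      threshold = good-threshold |E|≡m r (exponent-witness α α∈⟨0,1] r β<r)
      best≤ : size best ≤ size (proj₁ threshold)
      best≤ = All.lookup (f[argmin]≤f[xs] {f = size} 0 (upTo m))
                         (∈-upTo⁺ (proj₁ (proj₂ threshold)))
      size-bound : PowBound (size (proj₁ threshold)) (θ′-constant C N) m ∣ ↥ r ∣ (↧ₙ r)
      size-bound = proj₂ (proj₂ threshold)
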